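{- Let $N=(V,E,r,X)$ be a DC $X$-network, and let $V'\subseteq V$ be a set of vertices containing the root $r$ and every leaf $x\in X$. Then there exists a unique DC $X$-network $N'$ such that (1) $V(N')=V'$; (2) $N'$ has no redundant arcs; (3) $N'$ is a cluster-preserving simplification (CPS) of $N$.
   Context: An $X$-network $N=(V,E,r,X)$ is a finite directed graph $(V,E)$ (no loops, no multiple arcs) that is acyclic, has a root $r$ (every vertex is reachable from $r$ by a directed path), and whose leaves (vertices of out-degree $0$) are identified bijectively with the finite set $X$. A directed path may have length $0$. The cluster of a vertex $v$ is $cl(v;N)=\{x\in X:\text{there is a directed path from } v \text{ to } x\}$. $N$ is distinct-cluster (DC) if distinct vertices have distinct clusters. Networks are considered up to isomorphism (a bijection of vertices preserving arcs and leaf labels). An arc $(a,b)$ is redundant if there is a directed path from $a$ to $b$ of length greater than $1$. Operations: for a vertex $v$ with $v\neq r$, $v\notin X$, with parents $q_1,\dots,q_k$ and children $c_1,\dots,c_m$, $D(v)N$ is obtained by deleting $v$ and all arcs incident with $v$ and adding the arcs $(q_i,c_j)$ for all $i,j$ (keeping a single copy if already present). For a redundant arc $(a,b)$, $D(a,b)N$ is obtained by deleting the arc $(a,b)$. These operations do not change the cluster of any remaining vertex. A DC $X$-network $N'$ is a cluster-preserving simplification (CPS) of $N$ if there is a sequence $N=N_0,\dots,N_k=N'$ ($k\ge 0$) of DC $X$-networks such that each $N_{i+1}$ equals $D(v)N_i$ for some vertex $v$ of $N_i$ (with $v$ not the root and not a leaf) or $D(a,b)N_i$ for some redundant arc $(a,b)$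 of $N_i$. Since the networks are DC, vertices are identified with their clusters; in particular vertices of a CPS $N'$ are identified with the vertices of $N$ having the same cluster, and "$V(N')=V'$" is understood via this identification. -}

module Defs where

open import Data.Nat using (ℕ)
open import Data.Fin using (Fin)
open import Data.Bool using (Bool; true; false; T)
open import Data.Product using (Σ; ∃; _×_; _,_)
open import Data.Sum using (_⊎_)
open import Relation.Nullary using (¬_)
open import Relation.Binary.PropositionalEquality using (_≡_; _≢_)
open import Relation.Binary.Construct.Closure.ReflexiveTransitive using (Star)
open import Relation.Binary.Construct.Closure.Transitive using (TransClosure)
open import Function.Bundles using (_⇔_)
open import Data.Fin.Subset using (Subset; _∈_)

-- Directed graphs on the vertex set Fin m; arcs given by a Boolean
-- adjacency function (hence no multiple arcs).
Arc : ∀ {m} → (Fin m → Fin m → Bool) → Fin m → Fin m → Set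
Arc arc a b = T (arc a b)

Path : ∀ {m} → (Fin m → Fin m → Bool) → Fin m → Fin m → Set
Path arc = Star (Arc arc)

Path⁺ : ∀ {m} → (Fin m → Fin m → Bool) → Fin m → Fin m → Set
Path⁺ arc = TransClosure (Arc arc)

-- An X-network with X = Fin n.
record Network (n : ℕ) : Set where
  field
    m       : ℕ
    arc     : Fin m → Fin m → Bool
    noLoop  : ∀ v → ¬ Arc arc v v
    acyclic : ∀ v → ¬ Path⁺ arc v v
    root    : Fin m
    rooted  : ∀ v → Path arc root v
    leaf    : Fin n → Fin m
    leaf-inj : ∀ x y → leaf x ≡ leaf y → x ≡ y
    leaves  : ∀ v → ((∀ w → ¬ Arc arc v w) ⇔ ∃ (λ x → leaf x ≡ v))

open Network public

module _ {n : ℕ} where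

  _⊢_⟶_ : (N : Network n) → Fin (m N) → Fin (m N) → Set
  N ⊢ a ⟶ b = Arc (arc N) a b

  InCl : (N : Network n) → Fin (m N) → Fin n → Set
  InCl N v x = Path (arc N) v (leaf N x)

  SameCl : (N : Network n) → Fin (m N) → (N' : Network n) → Fin (m N') → Set
  SameCl N u N' v = ∀ x → InCl N u x ⇔ InCl N' v x

  DC : Network n → Set
  DC N = ∀ u v → SameCl N u N v → u ≡ v

  Redundant : (N : Network n) → Fin (m N) → Fin (m N) → Set
  Redundant N a b = N ⊢ a ⟶ b × Σ (Fin (m N)) (λ c → N ⊢ a ⟶ c × Path⁺ (arc N) c b)

  NoRedundantArcs : Network n → Set
  NoRedundantArcs N = ∀ a b → ¬ Redundant N a b

  record Iso (N N' : Network n) : Set where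
    field
      f     : Fin (m N) → Fin (m N')
      f-inj : ∀ u v → f u ≡ f v → u ≡ v
      f-sur : ∀ w → ∃ (λ u → f u ≡ w)
      f-arc : ∀ u v → N ⊢ u ⟶ v ⇔ N' ⊢ f u ⟶ f v
      f-leaf : ∀ x → f (leaf N x) ≡ leaf N' x

  -- N' is (isomorphic to) D(v)N : emb identifies the vertices of N' with
  -- the vertices of N other than v.
  record IsDelVertex (N : Network n) (v : Fin (m N)) (N' : Network n) : Set where
    field
      v-not-root : v ≢ root N
      v-not-leaf : ∀ x → leaf N x ≢ v
      emb      : Fin (m N') → Fin (m N)
      emb-inj  : ∀ i j → emb i ≡ emb j → i ≡ j
      emb-≢v   : ∀ i → emb i ≢ v
      emb-sur  : ∀ u → u ≢ v → ∃ (λ i → emb i ≡ u)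
      emb-root : emb (root N') ≡ root N
      emb-leaf : ∀ x → emb (leaf N' x) ≡ leaf N x
      emb-arc  : ∀ i j → N' ⊢ i ⟶ j ⇔
                   (N ⊢ emb i ⟶ emb j ⊎ (N ⊢ emb i ⟶ v × N ⊢ v ⟶ emb j))

  record IsDelArc (N : Network n) (a b : Fin (m N)) (N' : Network n) : Set where
    field
      redundant : Redundant N a b
      emb      : Fin (m N') → Fin (m N)
      emb-inj  : ∀ i j → emb i ≡ emb j → i ≡ j
      emb-sur  : ∀ u → ∃ (λ i → emb i ≡ u)
      emb-root : emb (root N') ≡ root N
      emb-leaf : ∀ x → emb (leaf N' x) ≡ leaf N x
      emb-arc  : ∀ i j → N' ⊢ i ⟶ j ⇔
                   (N ⊢ emb i ⟶ emb j × ¬ (emb i ≡ a × emb j ≡ b))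

  data Step (N : Network n) (N' : Network n) : Set where
    delV : (v : Fin (m N)) → IsDelVertex N v N' → Step N N'
    delA : (a b : Fin (m N)) → IsDelArc N a b N' → Step N N'

  -- sequences N = N₀, …, N_k = N' of DC networks (up to isomorphism)
  data CPSeq (N : Network n) : Network n → Set where
    start : ∀ {N'} → DC N → Iso N N' → CPSeq N N'
    step  : ∀ {N₁ N₂} → CPSeq N N₁ → Step N₁ N₂ → DC N₂ → CPSeq N N₂

  CPS : Network n → Network n → Set
  CPS N N' = DC N' × CPSeq N N'

  -- V(N') = V', vertices identified via their clusters
  VerticesAre : (N : Network n) → Subset (m N) → Network n → Set
  VerticesAre N V' N' =
    (∀ w → Σ (Fin (m N)) (λ v → v ∈ V' × SameCl N v N' w)) ×
    (∀ v → v ∈ V' → Σ (Fin (m N')) (λ w → SameCl N v N' w))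

  Conditions : (N : Network n) → Subset (m N) → Network n → Set
  Conditions N V' N' = DC N' × VerticesAre N V' N' × NoRedundantArcs N' × CPS N N'

-- Each simplification step D(v) or D(a,b) embeds the smaller network into the
-- larger one so that reachability is preserved and reflected; hence clusters are preserved
-- and distinct clusters are inherited from N, so no step can break the DC property.
-- Existence: delete the vertices outside V′ one by one (such a vertex is neither the root
-- nor a leaf), then the redundant arcs one by one (deleting an arc creates no new redundant
-- arc). Uniqueness: a network satisfying (1)–(3) embeds into N with image exactly V′, so two
-- of them are related by a bijection preserving reachability both ways; without redundant
-- arcs the arcs are exactly the covering pairs of reachability, so it is an isomorphism.
module Submission where

open import Defs
open import Data.Nat using (ℕ)
open import Data.Product using (Σ; _×_)
open import Data.Fin.Subset using (Subset; _∈_)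

open import Data.Bool using (Bool; T; _∨_; _∧_)
open import Data.Bool.Properties using (T-∨; T-∧)
open import Data.Empty using (⊥; ⊥-elim)
open import Data.Fin using (Fin; zero; suc; toℕ; punchIn; punchOut) renaming (_≟_ to _≟ᶠ_)
open import Data.Fin.Properties
  using (¬Fin0; any?; pigeonhole; punchIn-injective; punchIn-punchOut; punchInᵢ≢i)
open import Data.Fin.Subset using (_∉_)
open import Data.Fin.Subset.Properties using (_∈?_)
open import Data.List using (List; []; _∷_; cartesianProduct; allFin)
open import Data.List.Membership.Propositional using () renaming (_∈_ to _∈ᴸ_)
open import Data.List.Membership.Propositional.Properties using (∈-cartesianProduct⁺; ∈-allFin)
open import Data.List.Relation.Unary.Any using (here; there)
open import Data.Nat as ℕ using (zero; suc; pred; z≤n; s≤s)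
open import Data.Nat.Properties using (≰⇒>; <⇒≤)
open import Data.Product using (∃-syntax; _,_; proj₁; proj₂)
import Data.Product as Product
open import Data.Sum using (_⊎_; inj₁; inj₂)
import Data.Sum as Sum
open import Function using (_∘_; id)
open import Function.Bundles using (_⇔_; mk⇔; module Equivalence)
open import Function.Properties.Equivalence using () renaming (trans to ⇔-trans; sym to ⇔-sym)
open import Relation.Binary.Construct.Closure.ReflexiveTransitive using (ε; _◅_; _◅◅_; gmap; concat)
open import Relation.Binary.Construct.Closure.Transitive using ([_]; _∷_; _++_)
open import Relation.Binary.PropositionalEquality
  using (_≡_; _≢_; refl; sym; trans; cong; subst; subst₂)
open import Relation.Nullary using (¬_; Dec; yes; no; ¬?)
open import Relation.Nullary.Decidable
  using (_×-dec_; T?; decidable-stable; isYes; toWitness; fromWitness)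

open Equivalence using (to; from)

-- Paths in finite digraphs

module Paths {m : ℕ} (R : Fin m → Fin m → Bool) where

  ⁺⇒* : ∀ {a b} → Path⁺ R a b → Path R a b
  ⁺⇒* [ e ]   = e ◅ ε
  ⁺⇒* (e ∷ p) = e ◅ ⁺⇒* p

  ◅*⇒⁺ : ∀ {a b c} → Arc R a b → Path R b c → Path⁺ R a c
  ◅*⇒⁺ e ε        = [ e ]
  ◅*⇒⁺ e (e′ ◅ p) = e ∷ ◅*⇒⁺ e′ p

  ⁺⇒◅* : ∀ {a c} → Path⁺ R a c → ∃[ b ] Arc R a b × Path R b c
  ⁺⇒◅* [ e ]   = _ , e , ε
  ⁺⇒◅* (e ∷ p) = _ , e , ⁺⇒* p

  *◅◅⁺ : ∀ {a b c} → Path R a b → Path⁺ R b c → Path⁺ R a c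
  *◅◅⁺ ε       q = q
  *◅◅⁺ (e ◅ p) q = ◅*⇒⁺ e (p ◅◅ ⁺⇒* q)

  length : ∀ {a b} → Path R a b → ℕ
  length ε       = 0
  length (_ ◅ p) = suc (length p)

  vertexAt : ∀ {a b} (p : Path R a b) → Fin (suc (length p)) → Fin m
  vertexAt {a} p       zero    = a
  vertexAt     (_ ◅ p) (suc i) = vertexAt p i

  prefix : ∀ {a b} (p : Path R a b) i → Path R a (vertexAt p i)
  prefix p       zero    = ε
  prefix (e ◅ p) (suc i) = e ◅ prefix p i

  segment : ∀ {a b} (p : Path R a b) i j → toℕ i ℕ.< toℕ j →
            Path⁺ R (vertexAt p i) (vertexAt p j)
  segment (e ◅ p) zero    (suc j) _         = ◅*⇒⁺ e (prefix p j)
  segment (e ◅ p) (suc i) (suc j) (s≤s i<j) = segment p i j i<j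

  module Acyclic (acyclic : ∀ v → ¬ Path⁺ R v v) where

    Path-antisym : ∀ {a b} → Path R a b → Path R b a → a ≡ b
    Path-antisym ε       _ = refl
    Path-antisym (e ◅ p) q = ⊥-elim (acyclic _ (◅*⇒⁺ e (p ◅◅ q)))

    length<m : ∀ {a b} (p : Path R a b) → length p ℕ.< m
    length<m p = ≰⇒> λ m≤length → repeatedVertex (pigeonhole (s≤s m≤length) (vertexAt p))
      where
      repeatedVertex : ∃[ i ] ∃[ j ] toℕ i ℕ.< toℕ j × vertexAt p i ≡ vertexAt p j → ⊥
      repeatedVertex (i , j , i<j , eq) =
        acyclic _ (subst (λ a → Path⁺ R a (vertexAt p j)) eq (segment p i j i<j))

    -- Every path has fewer than m arcs, so searching to depth m decides reachability.
    private
      PathWithin : ℕ → Fin m → Fin m → Set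
      PathWithin k a b = Σ (Path R a b) (λ p → length p ℕ.≤ k)

      pathWithin? : ∀ k a b → Dec (PathWithin k a b)
      pathWithin? k a b with a ≟ᶠ b
      ... | yes refl = yes (ε , z≤n)
      pathWithin? zero a b | no a≢b = no λ { (ε , _) → a≢b refl ; (_ ◅ _ , ()) }
      pathWithin? (suc k) a b | no a≢b
        with any? (λ c → T? (R a c) ×-dec pathWithin? k c b)
      ... | yes (c , e , p , le) = yes (e ◅ p , s≤s le)
      ... | no ¬step = no λ { (ε , _) → a≢b refl ; (e ◅ p , s≤s le) → ¬step (_ , e , p , le) }

    Path? : ∀ a b → Dec (Path R a b)
    Path? a b with pathWithin? m a b
    ... | yes (p , _) = yes p
    ... | no ¬p       = no λ p → ¬p (p , <⇒≤ (length<m p))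

    Path⁺? : ∀ a b → Dec (Path⁺ R a b)
    Path⁺? a b with any? (λ c → T? (R a c) ×-dec Path? c b)
    ... | yes (c , e , p) = yes (◅*⇒⁺ e p)
    ... | no ¬p           = no λ p → ¬p (⁺⇒◅* p)

module _ {m m′ : ℕ} {R : Fin m → Fin m → Bool} {R′ : Fin m′ → Fin m′ → Bool}
         (f : Fin m′ → Fin m) (arc⇒path⁺ : ∀ {i j} → Arc R′ i j → Path⁺ R (f i) (f j)) where

  concatMap⁺ : ∀ {i j} → Path⁺ R′ i j → Path⁺ R (f i) (f j)
  concatMap⁺ [ e ]   = arc⇒path⁺ e
  concatMap⁺ (e ∷ p) = arc⇒path⁺ e ++ concatMap⁺ p

  acyclic-reflected : (∀ v → ¬ Path⁺ R v v) → ∀ i → ¬ Path⁺ R′ i i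
  acyclic-reflected acyclic i p = acyclic (f i) (concatMap⁺ p)

module _ {m m′ : ℕ} {R : Fin m → Fin m → Bool} {R′ : Fin m′ → Fin m′ → Bool}
         (e : Fin m′ → Fin m) (e-injective : ∀ i j → e i ≡ e j → i ≡ j)
         (e-surjective : ∀ u → ∃[ i ] e i ≡ u)
         (e-arc : ∀ i j → Arc R′ i j ⇔ Arc R (e i) (e j)) where

  bijection-path : ∀ i j → Path R′ i j ⇔ Path R (e i) (e j)
  bijection-path i j = mk⇔ (gmap e λ {x} {y} → to (e-arc x y)) (λ p → lift p refl refl)
    where
    lift : ∀ {s t} → Path R s t → ∀ {i j} → e i ≡ s → e j ≡ t → Path R′ i j
    lift ε refl q with e-injective _ _ q
    ... | refl = ε
    lift (_◅_ {j = c} a p) refl q with e-surjective c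
    ... | k , refl = from (e-arc _ k) a ◅ lift p refl q

-- Embeddings preserving and reflecting reachability

module _ {n : ℕ} where

  record Embedding (N′ N : Network n) : Set where
    field
      emb      : Fin (m N′) → Fin (m N)
      emb-path : ∀ i j → Path (arc N′) i j ⇔ Path (arc N) (emb i) (emb j)
      emb-leaf : ∀ x → emb (leaf N′ x) ≡ leaf N x

  module EmbeddingProperties {N′ N : Network n} (E : Embedding N′ N) where
    open Embedding E public

    emb-injective : ∀ i j → emb i ≡ emb j → i ≡ j
    emb-injective i j eq =
      Path-antisym (from (emb-path i j) (subst (Path (arc N) (emb i)) eq ε))
                   (from (emb-path j i) (subst (Path (arc N) (emb j)) (sym eq) ε))
      where open Paths.Acyclic (arc N′) (acyclic N′)

    emb-sameCl : ∀ i → SameCl N (emb i) N′ i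
    emb-sameCl i x = mk⇔
      (λ p → from (emb-path i _) (subst (Path (arc N) (emb i)) (sym (emb-leaf x)) p))
      (λ p → subst (Path (arc N) (emb i)) (emb-leaf x) (to (emb-path i _) p))

    emb-root : ∃[ w ] emb w ≡ root N → emb (root N′) ≡ root N
    emb-root (w , w↦root) = Path-antisym
      (subst (Path (arc N) _) w↦root (to (emb-path (root N′) w) (rooted N′ w))) (rooted N _)
      where open Paths.Acyclic (arc N) (acyclic N)

    DC-reflected : DC N → DC N′
    DC-reflected dc i j sameCl = emb-injective i j (dc (emb i) (emb j) λ x →
      ⇔-trans (emb-sameCl i x) (⇔-trans (sameCl x) (⇔-sym (emb-sameCl j x))))

  Iso-refl : (N : Network n) → Iso N N
  Iso-refl N = record
    { f = id ; f-inj = λ _ _ → id ; f-sur = λ w → w , refl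
    ; f-arc = λ _ _ → mk⇔ id id ; f-leaf = λ _ → refl }

  Embedding-trans : ∀ {N₂ N₁ N} → Embedding N₂ N₁ → Embedding N₁ N → Embedding N₂ N
  Embedding-trans E F = record
    { emb      = F.emb ∘ E.emb
    ; emb-path = λ i j → ⇔-trans (E.emb-path i j) (F.emb-path _ _)
    ; emb-leaf = λ x → trans (cong F.emb (E.emb-leaf x)) (F.emb-leaf x)
    }
    where
    module E = Embedding E
    module F = Embedding F

  Iso⇒Embedding : ∀ {N N′} → Iso N N′ → Embedding N′ N
  Iso⇒Embedding {N} {N′} I = record { emb = f⁻¹ ; emb-path = path ; emb-leaf = leaf′ }
    where
    open Iso I
    f⁻¹ : Fin (m N′) → Fin (m N)
    f⁻¹ w = proj₁ (f-sur w)
    f∘f⁻¹ : ∀ w → f (f⁻¹ w) ≡ w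
    f∘f⁻¹ w = proj₂ (f-sur w)
    path : ∀ i j → Path (arc N′) i j ⇔ Path (arc N) (f⁻¹ i) (f⁻¹ j)
    path i j = ⇔-sym (subst₂ (λ i′ j′ → Path (arc N) (f⁻¹ i) (f⁻¹ j) ⇔ Path (arc N′) i′ j′)
                             (f∘f⁻¹ i) (f∘f⁻¹ j)
                             (bijection-path f f-inj f-sur f-arc (f⁻¹ i) (f⁻¹ j)))
    leaf′ : ∀ x → f⁻¹ (leaf N′ x) ≡ leaf N x
    leaf′ x = f-inj _ _ (trans (f∘f⁻¹ _) (sym (f-leaf x)))

-- The simplification steps D(v) and D(a,b)

module VertexDeletionPaths {n : ℕ} (N : Network n) (v : Fin (m N))
  {m′ : ℕ} (R′ : Fin m′ → Fin m′ → Bool) (emb : Fin m′ → Fin (m N))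
  (emb-injective : ∀ i j → emb i ≡ emb j → i ≡ j) (emb-≢v : ∀ i → emb i ≢ v)
  (emb-surjective : ∀ u → u ≢ v → ∃[ i ] emb i ≡ u)
  (emb-arc : ∀ i j → Arc R′ i j ⇔ (N ⊢ emb i ⟶ emb j ⊎ (N ⊢ emb i ⟶ v × N ⊢ v ⟶ emb j)))
  where

  arc⇒path⁺ : ∀ {i j} → Arc R′ i j → Path⁺ (arc N) (emb i) (emb j)
  arc⇒path⁺ {i} {j} e with to (emb-arc i j) e
  ... | inj₁ e₁        = [ e₁ ]
  ... | inj₂ (e₁ , e₂) = e₁ ∷ [ e₂ ]

  deletion-path : ∀ i j → Path R′ i j ⇔ Path (arc N) (emb i) (emb j)
  deletion-path i j = mk⇔ (concat ∘ gmap emb (Paths.⁺⇒* (arc N) ∘ arc⇒path⁺)) (λ p → lift p refl refl)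
    where
    lift : ∀ {s t} → Path (arc N) s t → ∀ {i j} → emb i ≡ s → emb j ≡ t → Path R′ i j
    lift ε refl q with emb-injective _ _ q
    ... | refl = ε
    lift (_◅_ {j = c} e p) refl q with c ≟ᶠ v
    lift (_◅_ {j = c} e p) refl q | no c≢v with emb-surjective c c≢v
    ... | k , refl = from (emb-arc _ k) (inj₁ e) ◅ lift p refl q
    lift (e ◅ ε) refl q | yes refl = ⊥-elim (emb-≢v _ q)
    lift (e ◅ _◅_ {j = d} e′ p) refl q | yes refl with d ≟ᶠ v
    ... | yes refl = ⊥-elim (noLoop N v e′)
    ... | no d≢v with emb-surjective d d≢v
    ...   | k , refl = from (emb-arc _ k) (inj₂ (e , e′)) ◅ lift p refl q

module ArcDeletionPaths {n : ℕ} (N : Network n) (a b : Fin (m N)) (redundant : Redundant N a b)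
  {m′ : ℕ} (R′ : Fin m′ → Fin m′ → Bool) (emb : Fin m′ → Fin (m N))
  (emb-injective : ∀ i j → emb i ≡ emb j → i ≡ j) (emb-surjective : ∀ u → ∃[ i ] emb i ≡ u)
  (emb-arc : ∀ i j → Arc R′ i j ⇔ (N ⊢ emb i ⟶ emb j × ¬ (emb i ≡ a × emb j ≡ b)))
  where

  c : Fin (m N)
  c = proj₁ (proj₂ redundant)

  a⟶c : N ⊢ a ⟶ c
  a⟶c = proj₁ (proj₂ (proj₂ redundant))

  c⇝⁺b : Path⁺ (arc N) c b
  c⇝⁺b = proj₂ (proj₂ (proj₂ redundant))

  arc⇒arc : ∀ {i j} → Arc R′ i j → N ⊢ emb i ⟶ emb j
  arc⇒arc {i} {j} = proj₁ ∘ to (emb-arc i j)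

  c≢b : c ≢ b
  c≢b refl = acyclic N c c⇝⁺b

  deletion-path : ∀ i j → Path R′ i j ⇔ Path (arc N) (emb i) (emb j)
  deletion-path i j = mk⇔ (gmap emb arc⇒arc) (λ p → lift p refl refl)
    where
    liftArc : ∀ {s t} → N ⊢ s ⟶ t → ¬ (s ≡ a × t ≡ b) →
              ∀ {i j} → emb i ≡ s → emb j ≡ t → Arc R′ i j
    liftArc e ¬ab refl refl = from (emb-arc _ _) (e , ¬ab)

    liftAvoiding : ∀ {s t} → Path (arc N) s t → ¬ Path (arc N) s a →
                   ∀ {i j} → emb i ≡ s → emb j ≡ t → Path R′ i j
    liftAvoiding ε _ refl q with emb-injective _ _ q
    ... | refl = ε
    liftAvoiding (_◅_ {j = d} e p) ¬s⇝a refl q with emb-surjective d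
    ... | k , refl =
      liftArc e (λ (s≡a , _) → ¬s⇝a (subst (Path (arc N) _) s≡a ε)) refl refl
        ◅ liftAvoiding p (¬s⇝a ∘ (e ◅_)) refl q

    -- The arc (a , b) is replaced by the detour a ⟶ c ⇝ b, which never returns to a.
    detour : ∀ {i j} → emb i ≡ a → emb j ≡ b → Path R′ i j
    detour i≡a j≡b with emb-surjective c
    ... | k , k≡c = liftArc a⟶c (c≢b ∘ proj₂) i≡a k≡c
                      ◅ liftAvoiding (Paths.⁺⇒* (arc N) c⇝⁺b)
                                     (λ c⇝a → acyclic N a (Paths.◅*⇒⁺ (arc N) a⟶c c⇝a)) k≡c j≡b

    lift : ∀ {s t} → Path (arc N) s t → ∀ {i j} → emb i ≡ s → emb j ≡ t → Path R′ i j
    lift ε refl q with emb-injective _ _ q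
    ... | refl = ε
    lift (_◅_ {i = s} {j = d} e p) refl q with emb-surjective d | s ≟ᶠ a | d ≟ᶠ b
    ... | k , k≡d | yes s≡a | yes d≡b = detour s≡a (trans k≡d d≡b) ◅◅ lift p k≡d q
    ... | k , k≡d | no s≢a  | _       = liftArc e (s≢a ∘ proj₁) refl k≡d ◅ lift p k≡d q
    ... | k , k≡d | yes _   | no d≢b  = liftArc e (d≢b ∘ proj₂) refl k≡d ◅ lift p k≡d q

module _ {n : ℕ} where

  Step⇒Embedding : ∀ {N₁ N₂ : Network n} → Step N₁ N₂ → Embedding N₂ N₁
  Step⇒Embedding {N₁} {N₂} (delV v D) = record
    { emb = emb
    ; emb-path = VertexDeletionPaths.deletion-path N₁ v (arc N₂) emb emb-inj emb-≢v emb-sur emb-arc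
    ; emb-leaf = emb-leaf
    }
    where open IsDelVertex D
  Step⇒Embedding {N₁} {N₂} (delA a b D) = record
    { emb = emb
    ; emb-path = ArcDeletionPaths.deletion-path N₁ a b redundant (arc N₂) emb emb-inj emb-sur emb-arc
    ; emb-leaf = emb-leaf
    }
    where open IsDelArc D

  CPSeq⇒Embedding : ∀ {N N′ : Network n} → CPSeq N N′ → Embedding N′ N
  CPSeq⇒Embedding (start _ I)   = Iso⇒Embedding I
  CPSeq⇒Embedding (step s st _) = Embedding-trans (Step⇒Embedding st) (CPSeq⇒Embedding s)

  CPSeq-step : ∀ {N C C′ : Network n} → DC N → CPSeq N C → Step C C′ → CPSeq N C′
  CPSeq-step dcN seq st =
    step seq st (DC-reflected dcN)
    where open EmbeddingProperties (Embedding-trans (Step⇒Embedding st) (CPSeq⇒Embedding seq))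

  leaf-sink : (N : Network n) (x : Fin n) (w : Fin (m N)) → ¬ N ⊢ leaf N x ⟶ w
  leaf-sink N x = from (leaves N (leaf N x)) (x , refl)

  outArc⊎leaf : (N : Network n) (u : Fin (m N)) → (∃[ w ] N ⊢ u ⟶ w) ⊎ (∃[ x ] leaf N x ≡ u)
  outArc⊎leaf N u with any? (λ w → T? (arc N u w))
  ... | yes out = inj₁ out
  ... | no ¬out = inj₂ (to (leaves N u) λ w e → ¬out (w , e))

  Redundant? : (N : Network n) → ∀ a b → Dec (Redundant N a b)
  Redundant? N a b = T? (arc N a b) ×-dec any? (λ c → T? (arc N a c) ×-dec Path⁺? c b)
    where open Paths.Acyclic (arc N) (acyclic N)

-- Vertices of D(v)N are numbered by Fin (m - 1) via punchIn v; m ≠ 0 since v : Fin m.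
punchIn′ : ∀ {m} → Fin m → Fin (pred m) → Fin m
punchIn′ {suc _} = punchIn

punchOut′ : ∀ {m} {v u : Fin m} → u ≢ v → Fin (pred m)
punchOut′ {suc _} u≢v = punchOut (u≢v ∘ sym)

punchIn′-punchOut′ : ∀ {m} {v u : Fin m} (u≢v : u ≢ v) → punchIn′ v (punchOut′ u≢v) ≡ u
punchIn′-punchOut′ {suc _} u≢v = punchIn-punchOut (u≢v ∘ sym)

punchIn′-injective : ∀ {m} (v : Fin m) i j → punchIn′ v i ≡ punchIn′ v j → i ≡ j
punchIn′-injective {suc _} = punchIn-injective

punchIn′≢ : ∀ {m} (v : Fin m) i → punchIn′ v i ≢ v
punchIn′≢ {suc _} = punchInᵢ≢i

module VertexDeletion {n : ℕ} (N : Network n) (v : Fin (m N))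
  (v≢root : v ≢ root N) (leaf≢v : ∀ x → leaf N x ≢ v) where

  ι : Fin (pred (m N)) → Fin (m N)
  ι = punchIn′ v

  arc′ : Fin (pred (m N)) → Fin (pred (m N)) → Bool
  arc′ i j = arc N (ι i) (ι j) ∨ (arc N (ι i) v ∧ arc N v (ι j))

  arc′⇔ : ∀ i j → Arc arc′ i j ⇔ (N ⊢ ι i ⟶ ι j ⊎ (N ⊢ ι i ⟶ v × N ⊢ v ⟶ ι j))
  arc′⇔ i j = ⇔-trans T-∨ (mk⇔ (Sum.map₂ (to T-∧)) (Sum.map₂ (from T-∧)))

  ι-surjective : ∀ u → u ≢ v → ∃[ i ] ι i ≡ u
  ι-surjective u u≢v = punchOut′ u≢v , punchIn′-punchOut′ u≢v

  open VertexDeletionPaths N v arc′ ι (punchIn′-injective v) (punchIn′≢ v) ι-surjective arc′⇔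

  acyclic′ : ∀ i → ¬ Path⁺ arc′ i i
  acyclic′ = acyclic-reflected ι arc⇒path⁺ (acyclic N)

  root′ : Fin (pred (m N))
  root′ = punchOut′ (v≢root ∘ sym)

  leaf′ : Fin n → Fin (pred (m N))
  leaf′ x = punchOut′ (leaf≢v x)

  ι-leaf′ : ∀ x → ι (leaf′ x) ≡ leaf N x
  ι-leaf′ x = punchIn′-punchOut′ (leaf≢v x)

  toArc′ : ∀ u {w} (w≢v : w ≢ v) → N ⊢ ι u ⟶ w ⊎ (N ⊢ ι u ⟶ v × N ⊢ v ⟶ w) →
           Arc arc′ u (punchOut′ w≢v)
  toArc′ u w≢v e = from (arc′⇔ u _)
    (subst (λ w → N ⊢ ι u ⟶ w ⊎ (N ⊢ ι u ⟶ v × N ⊢ v ⟶ w)) (sym (punchIn′-punchOut′ w≢v)) e)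

  sink⇔leaf : ∀ u → (∀ w → ¬ Arc arc′ u w) ⇔ (∃[ x ] leaf′ x ≡ u)
  sink⇔leaf u = mk⇔ sink⇒leaf leaf⇒sink
    where
    sink⇒leaf : (∀ w → ¬ Arc arc′ u w) → ∃[ x ] leaf′ x ≡ u
    sink⇒leaf sink with outArc⊎leaf N (ι u)
    ... | inj₂ (x , eq) = x , punchIn′-injective v _ _ (trans (punchIn′-punchOut′ _) eq)
    ... | inj₁ (w , e) with w ≟ᶠ v
    ...   | no w≢v = ⊥-elim (sink _ (toArc′ u w≢v (inj₁ e)))
    ...   | yes refl with outArc⊎leaf N v   -- v is not a leaf, so the arc into v continues
    ...     | inj₂ (x , eq) = ⊥-elim (leaf≢v x eq)
    ...     | inj₁ (d , e′) = ⊥-elim (sink _ (toArc′ u {d} (λ { refl → noLoop N v e′ }) (inj₂ (e , e′))))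
    leaf⇒sink : ∃[ x ] leaf′ x ≡ u → ∀ w → ¬ Arc arc′ u w
    leaf⇒sink (x , refl) w e with to (arc′⇔ _ w) e
    ... | inj₁ e₁       = leaf-sink N x _ (subst (λ z → N ⊢ z ⟶ _) (ι-leaf′ x) e₁)
    ... | inj₂ (e₁ , _) = leaf-sink N x _ (subst (λ z → N ⊢ z ⟶ _) (ι-leaf′ x) e₁)

  network : Network n
  network = record
    { m        = pred (m N)
    ; arc      = arc′
    ; noLoop   = λ i e → acyclic′ i [ e ]
    ; acyclic  = acyclic′
    ; root     = root′
    ; rooted   = λ w → from (deletion-path root′ w)
                   (subst (λ r → Path (arc N) r (ι w)) (sym (punchIn′-punchOut′ _)) (rooted N (ι w)))
    ; leaf     = leaf′
    ; leaf-inj = λ x y eq → leaf-inj N x y (trans (sym (ι-leaf′ x)) (trans (cong ι eq) (ι-leaf′ y)))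
    ; leaves   = sink⇔leaf
    }

  isDelVertex : IsDelVertex N v network
  isDelVertex = record
    { v-not-root = v≢root
    ; v-not-leaf = leaf≢v
    ; emb        = ι
    ; emb-inj    = punchIn′-injective v
    ; emb-≢v     = punchIn′≢ v
    ; emb-sur    = ι-surjective
    ; emb-root   = punchIn′-punchOut′ _
    ; emb-leaf   = ι-leaf′
    ; emb-arc    = arc′⇔
    }

module ArcDeletion {n : ℕ} (N : Network n) (a b : Fin (m N)) (redundant : Redundant N a b) where

  arc′ : Fin (m N) → Fin (m N) → Bool
  arc′ x y = arc N x y ∧ isYes (¬? ((x ≟ᶠ a) ×-dec (y ≟ᶠ b)))

  arc′⇔ : ∀ x y → Arc arc′ x y ⇔ (N ⊢ x ⟶ y × ¬ (x ≡ a × y ≡ b))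
  arc′⇔ x y = ⇔-trans T-∧ (mk⇔ (Product.map₂ toWitness) (Product.map₂ fromWitness))

  open ArcDeletionPaths N a b redundant arc′ id (λ _ _ → id) (λ u → u , refl) arc′⇔

  acyclic′ : ∀ i → ¬ Path⁺ arc′ i i
  acyclic′ = acyclic-reflected id ([_] ∘ arc⇒arc) (acyclic N)

  sink⇔sink : ∀ u → (∀ w → ¬ Arc arc′ u w) ⇔ (∀ w → ¬ N ⊢ u ⟶ w)
  sink⇔sink u = mk⇔ sink′⇒sink (λ sink w → sink w ∘ arc⇒arc)
    where
    sink′⇒sink : (∀ w → ¬ Arc arc′ u w) → ∀ w → ¬ N ⊢ u ⟶ w
    sink′⇒sink sink′ w e with (u ≟ᶠ a) ×-dec (w ≟ᶠ b)
    ... | no ¬ab         = sink′ w (from (arc′⇔ u w) (e , ¬ab))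
    ... | yes (refl , _) = sink′ c (from (arc′⇔ a c) (a⟶c , c≢b ∘ proj₂))

  network : Network n
  network = record
    { m        = m N
    ; arc      = arc′
    ; noLoop   = λ i e → acyclic′ i [ e ]
    ; acyclic  = acyclic′
    ; root     = root N
    ; rooted   = λ w → from (deletion-path (root N) w) (rooted N w)
    ; leaf     = leaf N
    ; leaf-inj = leaf-inj N
    ; leaves   = λ u → ⇔-trans (sink⇔sink u) (leaves N u)
    }

  isDelArc : IsDelArc N a b network
  isDelArc = record
    { redundant = redundant
    ; emb       = id
    ; emb-inj   = λ _ _ → id
    ; emb-sur   = λ u → u , refl
    ; emb-root  = refl
    ; emb-leaf  = λ _ → refl
    ; emb-arc   = arc′⇔
    }

  Redundant-reflected : ∀ x y → Redundant network x y → Redundant N x y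
  Redundant-reflected x y (x⟶y , d , x⟶d , d⇝⁺y) =
    arc⇒arc x⟶y , d , arc⇒arc x⟶d , concatMap⁺ id ([_] ∘ arc⇒arc) d⇝⁺y

  arc-removed : ¬ network ⊢ a ⟶ b
  arc-removed e = proj₂ (to (arc′⇔ a b) e) (refl , refl)

-- Uniqueness

module _ {n : ℕ} where

  Covers : (N : Network n) → Fin (m N) → Fin (m N) → Set
  Covers N a b = a ≢ b × Path (arc N) a b ×
                 (∀ c → Path (arc N) a c → Path (arc N) c b → c ≡ a ⊎ c ≡ b)

  module _ (N : Network n) (irredundant : NoRedundantArcs N) where

    arc⇒Covers : ∀ a b → N ⊢ a ⟶ b → Covers N a b
    arc⇒Covers a b a⟶b = (λ { refl → noLoop N a a⟶b }) , a⟶b ◅ ε , between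
      where
      between : ∀ c → Path (arc N) a c → Path (arc N) c b → c ≡ a ⊎ c ≡ b
      between c ε       _         = inj₁ refl
      between c (_ ◅ _) ε         = inj₂ refl
      between c (e ◅ p) (e′ ◅ q) =
        ⊥-elim (irredundant a b (a⟶b , _ , e , Paths.*◅◅⁺ (arc N) p (Paths.◅*⇒⁺ (arc N) e′ q)))

    Covers⇒arc : ∀ a b → Covers N a b → N ⊢ a ⟶ b
    Covers⇒arc a b (a≢b , ε , _) = ⊥-elim (a≢b refl)
    Covers⇒arc a b (_ , _◅_ {j = d} e p , between) with between d (e ◅ ε) p
    ... | inj₁ refl = ⊥-elim (noLoop N a e)
    ... | inj₂ refl = e

  pathBijection⇒Iso : (A B : Network n) → NoRedundantArcs A → NoRedundantArcs B →
    (f : Fin (m A) → Fin (m B)) → (∀ u v → f u ≡ f v → u ≡ v) → (∀ w → ∃[ u ] f u ≡ w) →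
    (∀ u v → Path (arc A) u v ⇔ Path (arc B) (f u) (f v)) →
    (∀ x → f (leaf A x) ≡ leaf B x) → Iso A B
  pathBijection⇒Iso A B irredundantA irredundantB f f-inj f-sur f-path f-leaf = record
    { f      = f
    ; f-inj  = f-inj
    ; f-sur  = f-sur
    ; f-arc  = λ u v → mk⇔
        (Covers⇒arc B irredundantB _ _ ∘ Covers-preserved ∘ arc⇒Covers A irredundantA u v)
        (Covers⇒arc A irredundantA _ _ ∘ Covers-reflected ∘ arc⇒Covers B irredundantB _ _)
    ; f-leaf = f-leaf
    }
    where
    Covers-preserved : ∀ {u v} → Covers A u v → Covers B (f u) (f v)
    Covers-preserved {u} {v} (u≢v , p , between) = u≢v ∘ f-inj u v , to (f-path u v) p , between′
      where
      between′ : ∀ c → Path (arc B) (f u) c → Path (arc B) c (f v) → c ≡ f u ⊎ c ≡ f v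
      between′ c p₁ p₂ with f-sur c
      ... | c′ , refl = Sum.map (cong f) (cong f)
                          (between c′ (from (f-path u c′) p₁) (from (f-path c′ v) p₂))

    Covers-reflected : ∀ {u v} → Covers B (f u) (f v) → Covers A u v
    Covers-reflected {u} {v} (fu≢fv , p , between) = fu≢fv ∘ cong f , from (f-path u v) p , between′
      where
      between′ : ∀ c → Path (arc A) u c → Path (arc A) c v → c ≡ u ⊎ c ≡ v
      between′ c p₁ p₂ = Sum.map (f-inj _ _) (f-inj _ _)
                           (between (f c) (to (f-path u c) p₁) (to (f-path c v) p₂))

  sameImage⇒Iso : ∀ {A B N : Network n} (E : Embedding A N) (F : Embedding B N) →
    NoRedundantArcs A → NoRedundantArcs B →
    (∀ i → ∃[ j ] Embedding.emb F j ≡ Embedding.emb E i) →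
    (∀ j → ∃[ i ] Embedding.emb E i ≡ Embedding.emb F j) → Iso A B
  sameImage⇒Iso {A} {B} {N} E F irredundantA irredundantB E⊆F F⊆E =
    pathBijection⇒Iso A B irredundantA irredundantB f f-inj f-sur f-path f-leaf
    where
    module E = EmbeddingProperties E
    module F = EmbeddingProperties F
    f : Fin (m A) → Fin (m B)
    f i = proj₁ (E⊆F i)
    F∘f : ∀ i → F.emb (f i) ≡ E.emb i
    F∘f i = proj₂ (E⊆F i)
    f-inj : ∀ i j → f i ≡ f j → i ≡ j
    f-inj i j eq = E.emb-injective i j (trans (sym (F∘f i)) (trans (cong F.emb eq) (F∘f j)))
    f-sur : ∀ j → ∃[ i ] f i ≡ j
    f-sur j = let (i , Ei≡Fj) = F⊆E j in i , F.emb-injective _ _ (trans (F∘f i) Ei≡Fj)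
    f-path : ∀ i j → Path (arc A) i j ⇔ Path (arc B) (f i) (f j)
    f-path i j = ⇔-trans (E.emb-path i j)
      (subst₂ (λ s t → Path (arc N) s t ⇔ Path (arc B) (f i) (f j)) (F∘f i) (F∘f j)
              (⇔-sym (F.emb-path (f i) (f j))))
    f-leaf : ∀ x → f (leaf A x) ≡ leaf B x
    f-leaf x = F.emb-injective _ _ (trans (F∘f _) (trans (E.emb-leaf x) (sym (F.emb-leaf x))))

  module ConditionsEmbedding {N : Network n} (dcN : DC N) {V′ : Subset (m N)} {A : Network n}
    (cond : Conditions N V′ A) where

    embedding : Embedding A N
    embedding = CPSeq⇒Embedding (proj₂ (proj₂ (proj₂ (proj₂ cond))))

    open EmbeddingProperties embedding public

    emb∈V′ : ∀ w → emb w ∈ V′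
    emb∈V′ w = let (v , v∈V′ , sameCl) = proj₁ (proj₁ (proj₂ cond)) w in
      subst (_∈ V′) (dcN v (emb w) λ x → ⇔-trans (sameCl x) (⇔-sym (emb-sameCl w x))) v∈V′

    V′⊆image : ∀ v → v ∈ V′ → ∃[ w ] emb w ≡ v
    V′⊆image v v∈V′ = let (w , sameCl) = proj₂ (proj₁ (proj₂ cond)) v v∈V′ in
      w , dcN (emb w) v λ x → ⇔-trans (emb-sameCl w x) (⇔-sym (sameCl x))

  Conditions-unique : ∀ {N : Network n} → DC N → ∀ {V′ A B} →
    Conditions N V′ A → Conditions N V′ B → Iso A B
  Conditions-unique dcN condA condB =
    sameImage⇒Iso A.embedding B.embedding (proj₁ (proj₂ (proj₂ condA))) (proj₁ (proj₂ (proj₂ condB)))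
      (λ i → B.V′⊆image _ (A.emb∈V′ i)) (λ j → A.V′⊆image _ (B.emb∈V′ j))
    where
    module A = ConditionsEmbedding dcN condA
    module B = ConditionsEmbedding dcN condB

-- Existence

module Existence {n : ℕ} (N : Network n) (dcN : DC N) (V′ : Subset (m N))
  (root∈V′ : root N ∈ V′) (leaf∈V′ : ∀ x → leaf N x ∈ V′) where

  record Reduct (C : Network n) : Set where
    field
      seq      : CPSeq N C
      V′⊆image : ∀ v → v ∈ V′ → ∃[ w ] Embedding.emb (CPSeq⇒Embedding seq) w ≡ v
    open EmbeddingProperties (CPSeq⇒Embedding seq) public

  Image⊆V′ : ∀ {C} → Reduct C → Set
  Image⊆V′ r = ∀ w → Reduct.emb r w ∈ V′

  record Solution : Set where
    field
      C           : Network n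
      reduct      : Reduct C
      image⊆V′    : Image⊆V′ reduct
      irredundant : NoRedundantArcs C

  module _ {C : Network n} (r : Reduct C) (w : Fin (m C)) (w∉V′ : Reduct.emb r w ∉ V′) where
    open Reduct r

    w≢root : w ≢ root C
    w≢root refl = w∉V′ (subst (_∈ V′) (sym (emb-root (V′⊆image _ root∈V′))) root∈V′)

    leaf≢w : ∀ x → leaf C x ≢ w
    leaf≢w x refl = w∉V′ (subst (_∈ V′) (sym (emb-leaf x)) (leaf∈V′ x))

    deleteVertex : Reduct (VertexDeletion.network C w w≢root leaf≢w)
    deleteVertex = record
      { seq      = CPSeq-step dcN seq (delV w (VertexDeletion.isDelVertex C w w≢root leaf≢w))
      ; V′⊆image = λ v v∈V′ → let (u , eu) = V′⊆image v v∈V′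
                                  u≢w : u ≢ w
                                  u≢w = λ { refl → w∉V′ (subst (_∈ V′) (sym eu) v∈V′) }
                              in punchOut′ u≢w , trans (cong emb (punchIn′-punchOut′ u≢w)) eu
      }

  prune : ∀ k {C} → m C ≡ k → Reduct C → Σ (Network n) (λ C′ → Σ (Reduct C′) Image⊆V′)
  prune k {C} size r with any? (λ w → ¬? (Reduct.emb r w ∈? V′))
  ... | no none = C , r , λ w → decidable-stable (Reduct.emb r w ∈? V′) (λ w∉V′ → none (w , w∉V′))
  prune zero    size r | yes (w , _)     = ⊥-elim (¬Fin0 (subst Fin size w))
  prune (suc k) size r | yes (w , w∉V′) = prune k (cong pred size) (deleteVertex r w w∉V′)

  deleteArc : ∀ {C} (r : Reduct C) a b (red : Redundant C a b) → Reduct (ArcDeletion.network C a b red)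
  deleteArc r a b red = record
    { seq      = CPSeq-step dcN (Reduct.seq r) (delA a b (ArcDeletion.isDelArc _ a b red))
    ; V′⊆image = Reduct.V′⊆image r
    }

  -- Deleting an arc creates no redundant arcs (Redundant-reflected), so one pass suffices.
  removeRedundant : ∀ {C} (r : Reduct C) → Image⊆V′ r → (pairs : List (Fin (m C) × Fin (m C))) →
    (∀ a b → ¬ Redundant C a b ⊎ (a , b) ∈ᴸ pairs) → Solution
  removeRedundant {C} r image⊆V′ [] unchecked = record
    { C = C ; reduct = r ; image⊆V′ = image⊆V′
    ; irredundant = λ a b → Sum.[ id , (λ ()) ]′ (unchecked a b) }
  removeRedundant {C} r image⊆V′ ((a , b) ∷ pairs) unchecked with Redundant? C a b
  ... | no ¬red = removeRedundant r image⊆V′ pairs unchecked′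
    where
    unchecked′ : ∀ x y → ¬ Redundant C x y ⊎ (x , y) ∈ᴸ pairs
    unchecked′ x y with unchecked x y
    ... | inj₁ ¬red′           = inj₁ ¬red′
    ... | inj₂ (here refl)     = inj₁ ¬red
    ... | inj₂ (there pending) = inj₂ pending
  ... | yes red = removeRedundant (deleteArc r a b red) image⊆V′ pairs unchecked′
    where
    open ArcDeletion C a b red using (network; Redundant-reflected; arc-removed)
    unchecked′ : ∀ x y → ¬ Redundant network x y ⊎ (x , y) ∈ᴸ pairs
    unchecked′ x y with unchecked x y
    ... | inj₁ ¬red′           = inj₁ (¬red′ ∘ Redundant-reflected x y)
    ... | inj₂ (here refl)     = inj₁ (arc-removed ∘ proj₁)
    ... | inj₂ (there pending) = inj₂ pending

  solution : Solution
  solution = let (_ , r , image⊆V′) = prune (m N) refl initial in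
    removeRedundant r image⊆V′ (cartesianProduct (allFin _) (allFin _))
      (λ a b → inj₂ (∈-cartesianProduct⁺ (∈-allFin a) (∈-allFin b)))
    where
    initial : Reduct N
    initial = record { seq = start dcN (Iso-refl N) ; V′⊆image = λ v _ → v , refl }

  open Solution solution

  conditions : Conditions N V′ C
  conditions = dcC , (in-V′ , V′-in) , irredundant , dcC , Reduct.seq reduct
    where
    open Reduct reduct
    dcC : DC C
    dcC = DC-reflected dcN
    in-V′ : ∀ w → Σ (Fin (m N)) (λ v → v ∈ V′ × SameCl N v C w)
    in-V′ w = emb w , image⊆V′ w , emb-sameCl w
    V′-in : ∀ v → v ∈ V′ → Σ (Fin (m C)) (λ w → SameCl N v C w)
    V′-in v v∈V′ = let (w , w↦v) = V′⊆image v v∈V′ in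
      w , subst (λ u → SameCl N u C w) w↦v (emb-sameCl w)

theorem7p3 : ∀ {n : ℕ} (N : Network n) → DC N →
    (V' : Subset (m N)) → root N ∈ V' → (∀ x → leaf N x ∈ V') →
    Σ (Network n) (λ N' → Conditions N V' N' ×
    (∀ N'' → Conditions N V' N'' → Iso N' N''))
theorem7p3 N dcN V′ root∈V′ leaf∈V′ =
  C , conditions , λ N″ conditions″ → Conditions-unique dcN conditions conditions″
  where
  open Existence N dcN V′ root∈V′ leaf∈V′
  open Solution solution
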